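{- In any execution of algorithm $\Gamma$ (described below), for all $0\le j\le n+1$ we have $r(j)\ge s(j)$; consequently $r(n+1)\ge\mathrm{dmin}(\sigma,w)$.
   Context: Let $P$ be a set with partial order $\triangleleft$. The input is $\delta\in(0,1]$, $\gamma>0$, and elements $\sigma(1),\ldots,\sigma(n)\in P$ with nonnegative integer weights $w(1),\ldots,w(n)$. A $\sigma$-path is a sequence of indices $\pi_1<\cdots<\pi_k$ in $[n]$ with $\sigma(\pi_1)\triangleleft\cdots\triangleleft\sigma(\pi_k)$; its defect is the sum of $w(j)$ over $j\in[n]$ not on the path, and $\mathrm{dmin}(\sigma,w)$ is the minimum defect over all $\sigma$-paths. Extend by $\sigma(n+1)$ greater than all elements of $P$ with $w(n+1)=0$, and an index $0$ with $\sigma(0)$ below everything. Write $i\to t$ for $i<t$ and $\sigma(i)\triangleleft\sigma(t)$. Let $W(0)=0$, $W(t)=W(t-1)+w(t)$. The exact values are $s(0)=0$ and, for $t\in[n+1]$, $s(t)=\min\{s(i)+W(t-1)-W(i): 0\le i<t,\ i\to t\}$ (so $s(n+1)=\mathrm{dmin}(\sigma,w)$). Define $q(i,t)=\min\{1,\frac{1+\delta}{\delta}\ln(4t^3/\gamma)\frac{w(i)}{W(t)-W(i-1)}\}$, $p(i,i)=1$, $p(i,t)=q(i,t)/q(i,t-1)$ for $t>i$. Algorithm $\Gamma$: initialize $R=\{0\}$, $r(0)=0$. For $t=1,\ldots,n+1$: set $r(t)=\min\{r(i)+W(t-1)-W(i): i\in R,\ i\to t\}$; insert $t$ into $R$; discard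 each $i\in R$, $i\ge1$, independently with probability $1-p(i,t)$ (index 0 is never discarded). -}

module Defs where

open import Level using (Level)
open import Data.Nat using (ℕ; zero; suc; _+_; _∸_; _≤_; _<_)
open import Data.Nat.Properties using (_≟_)
open import Data.List using (List; []; _∷_; map; upTo)
open import Data.Nat.ListAction using (sum)
open import Data.List.Membership.DecPropositional _≟_ using (_∈?_)
open import Data.Product using (Σ; _×_; ∃)
open import Data.Sum using (_⊎_)
open import Relation.Nullary using (¬_; Dec; yes; no)
open import Relation.Binary.PropositionalEquality using (_≡_)
open import Relation.Binary.Bundles using (StrictPartialOrder)

-- Indices of the input are 1..n; σ, w are given as functions on ℕ and only
-- their values at 1..n are ever used. Index 0 and n+1 are the virtual
-- bottom / top elements.

W : (ℕ → ℕ) → ℕ → ℕ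
W w zero    = 0
W w (suc t) = W w t + w (suc t)

module _ {a ℓ₁ ℓ₂ : Level} (P : StrictPartialOrder a ℓ₁ ℓ₂) where
  open StrictPartialOrder P renaming (Carrier to A; _<_ to _◁_)

  -- i → t  on the extended index set {0,…,n+1}:
  -- σ(0) lies below everything and σ(n+1) above everything.
  Arrow : (n : ℕ) (σ : ℕ → A) → ℕ → ℕ → Set ℓ₂
  Arrow n σ i t = i < t × (Lift' (i ≡ 0) ⊎ (Lift' (t ≡ suc n) ⊎ (σ i ◁ σ t)))
    where
    Lift' : Set → Set ℓ₂
    Lift' X = Level.Lift ℓ₂ X

  data IsPath (n : ℕ) (σ : ℕ → A) : List ℕ → Set (a Level.⊔ ℓ₂) where
    []  : IsPath n σ []
    [_] : ∀ {i} → 1 ≤ i → i ≤ n → IsPath n σ (i ∷ [])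
    _∷_ : ∀ {i j π} → 1 ≤ i → i < j → σ i ◁ σ j →
          IsPath n σ (j ∷ π) → IsPath n σ (i ∷ j ∷ π)

  defect : (n : ℕ) (w : ℕ → ℕ) → List ℕ → ℕ
  defect n w π = sum (map f (upTo n))
    where
    f : ℕ → ℕ
    f k with suc k ∈? π
    ... | yes _ = 0
    ... | no  _ = w (suc k)

  IsDmin : (n : ℕ) (σ : ℕ → A) (w : ℕ → ℕ) → ℕ → Set (a Level.⊔ ℓ₂)
  IsDmin n σ w d =
    (Σ (List ℕ) λ π → IsPath n σ π × defect n w π ≡ d) ×
    (∀ π → IsPath n σ π → d ≤ defect n w π)

  IsMinAt : (n : ℕ) (σ : ℕ → A) (w : ℕ → ℕ) (C : ℕ → Set) (f : ℕ → ℕ)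
            (t v : ℕ) → Set ℓ₂
  IsMinAt n σ w C f t v =
    (Σ ℕ λ i → Level.Lift ℓ₂ (C i) × Arrow n σ i t ×
               Level.Lift ℓ₂ (v ≡ f i + (W w (t ∸ 1) ∸ W w i))) ×
    (∀ i → C i → Arrow n σ i t → Level.Lift ℓ₂ (v ≤ f i + (W w (t ∸ 1) ∸ W w i)))

  IsExactS : (n : ℕ) (σ : ℕ → A) (w : ℕ → ℕ) (s : ℕ → ℕ) → Set ℓ₂
  IsExactS n σ w s =
    Level.Lift ℓ₂ (s 0 ≡ 0) ×
    (∀ t → 1 ≤ t → t ≤ suc n → IsMinAt n σ w (λ i → i < t) s t (s t))

  -- An execution of Γ: R t i means "i ∈ R after step t" (R 0 = {0}), and
  -- r t is computed at step t from the set R after step t-1.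
  -- Step t inserts t and then discards some indices i ≥ 1; index 0 is never
  -- discarded and t itself is not discarded at step t (p(t,t) = 1).
  IsExecution : (n : ℕ) (σ : ℕ → A) (w : ℕ → ℕ)
                (R : ℕ → ℕ → Set) (r : ℕ → ℕ) → Set ℓ₂
  IsExecution n σ w R r =
    Level.Lift ℓ₂
      ((∀ i → R 0 i → i ≡ 0) × R 0 0 ×
       (∀ t → 1 ≤ t → t ≤ suc n →
          R t 0 × R t t × (∀ i → R t i → R (t ∸ 1) i ⊎ i ≡ t)) ×
       r 0 ≡ 0) ×
    (∀ t → 1 ≤ t → t ≤ suc n → IsMinAt n σ w (R (t ∸ 1)) r t (r t))

module Submission where

-- Part one is strong induction on j: r(j) is a minimum of the same expressions as s(j), taken
-- over a subset of the candidates i, each of which already satisfies s(i) ≤ r(i).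
-- For part two, following the indices that attain the minima defining s backwards from n+1
-- gives a σ-path π, and along each step i → t the weights skipped in between are exactly
-- W(t-1) - W(i); hence defect(π) ≤ s(n+1), and dmin ≤ s(n+1) ≤ r(n+1).

open import Defs
open import Level using (Level; lift; lower)
open import Data.Nat using (ℕ; zero; suc; _+_; _∸_; _≤_; _<_; z≤n; s≤s)
open import Data.Nat.Properties
open import Data.Nat.Induction using (<-rec)
open import Data.Nat.ListAction using (sum)
open import Data.Nat.ListAction.Properties using (sum-++)
open import Data.List using (List; []; _∷_; _∷ʳ_; map; upTo; _++_)
open import Data.List.Properties using (map-++; ++-assoc; map-cong; upTo-∷ʳ)
open import Data.List.Membership.DecPropositional _≟_ using (_∈?_; _∈_)
open import Data.List.Membership.Propositional.Properties using (∈-++⁺ˡ; ∈-++⁺ʳ)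
open import Data.List.Relation.Unary.Any using (here)
open import Data.Product using (Σ; _×_; _,_; proj₁)
open import Data.Sum using (inj₁; inj₂)
open import Data.Empty using (⊥-elim)
open import Relation.Nullary using (yes; no)
open import Relation.Binary.Bundles using (StrictPartialOrder)
open import Relation.Binary.PropositionalEquality using (_≡_; refl; sym; trans; cong; cong₂; subst; module ≡-Reasoning)

W-mono : ∀ w {i m} → i ≤ m → W w i ≤ W w m
W-mono w {m = zero}  z≤n = ≤-refl
W-mono w {m = suc m} i≤1+m with m≤n⇒m<n∨m≡n i≤1+m
... | inj₂ refl    = ≤-refl
... | inj₁ (s≤s i≤m) = ≤-trans (W-mono w i≤m) (m≤m+n (W w m) (w (suc m)))

offPath : (ℕ → ℕ) → List ℕ → ℕ → ℕ
offPath w π k with k ∈? π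
... | yes _ = 0
... | no  _ = w k

offPath≤w : ∀ w π k → offPath w π k ≤ w k
offPath≤w w π k with k ∈? π
... | yes _ = z≤n
... | no  _ = ≤-refl

offPath-∈ : ∀ w {π k} → k ∈ π → offPath w π k ≡ 0
offPath-∈ w {π} {k} k∈π with k ∈? π
... | yes _  = refl
... | no k∉π = ⊥-elim (k∉π k∈π)

offPath-antimono : ∀ w {π π′} → (∀ {k} → k ∈ π → k ∈ π′) →
                   ∀ k → offPath w π′ k ≤ offPath w π k
offPath-antimono w {π} {π′} π⊆π′ k with k ∈? π | k ∈? π′
... | _      | yes _ = z≤n
... | yes k∈π | no k∉π′ = ⊥-elim (k∉π′ (π⊆π′ k∈π))
... | no _   | no _  = ≤-refl

offPathSum : (ℕ → ℕ) → List ℕ → ℕ → ℕ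
offPathSum w π zero    = 0
offPathSum w π (suc m) = offPathSum w π m + offPath w π (suc m)

offPathSum-antimono : ∀ w {π π′} → (∀ {k} → k ∈ π → k ∈ π′) →
                      ∀ m → offPathSum w π′ m ≤ offPathSum w π m
offPathSum-antimono w π⊆π′ zero    = z≤n
offPathSum-antimono w π⊆π′ (suc m) =
  +-mono-≤ (offPathSum-antimono w π⊆π′ m) (offPath-antimono w π⊆π′ (suc m))

offPathSum-≤-W : ∀ w π {i m} → i ≤ m →
                 offPathSum w π m ≤ offPathSum w π i + (W w m ∸ W w i)
offPathSum-≤-W w π {m = zero}  z≤n = z≤n
offPathSum-≤-W w π {m = suc m} i≤1+m with m≤n⇒m<n∨m≡n i≤1+m
... | inj₂ refl = begin
  offPathSum w π (suc m)                                   ≤⟨ m≤m+n _ _ ⟩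
  offPathSum w π (suc m) + 0                               ≡⟨ cong (offPathSum w π (suc m) +_) (sym (n∸n≡0 (W w (suc m)))) ⟩
  offPathSum w π (suc m) + (W w (suc m) ∸ W w (suc m))     ∎
  where open ≤-Reasoning
... | inj₁ (s≤s {i} i≤m) = begin
  offPathSum w π m + offPath w π (suc m)                   ≤⟨ +-mono-≤ (offPathSum-≤-W w π i≤m) (offPath≤w w π (suc m)) ⟩
  offPathSum w π i + (W w m ∸ W w i) + w (suc m)           ≡⟨ +-assoc (offPathSum w π i) _ _ ⟩
  offPathSum w π i + ((W w m ∸ W w i) + w (suc m))         ≡⟨ cong (offPathSum w π i +_) (sym (+-∸-comm (w (suc m)) (W-mono w i≤m))) ⟩
  offPathSum w π i + (W w (suc m) ∸ W w i)                 ∎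
  where open ≤-Reasoning

sum-offPath-upTo : ∀ w π m → sum (map (λ k → offPath w π (suc k)) (upTo m)) ≡ offPathSum w π m
sum-offPath-upTo w π zero    = refl
sum-offPath-upTo w π (suc m) = begin
  sum (map f (upTo (suc m)))         ≡⟨ cong (λ ks → sum (map f ks)) (sym (upTo-∷ʳ m)) ⟩
  sum (map f (upTo m ++ (m ∷ [])))      ≡⟨ cong sum (map-++ f (upTo m) (m ∷ [])) ⟩
  sum (map f (upTo m) ++ (f m ∷ []))    ≡⟨ sum-++ (map f (upTo m)) (f m ∷ []) ⟩
  sum (map f (upTo m)) + (f m + 0)   ≡⟨ cong₂ _+_ (sum-offPath-upTo w π m) (+-identityʳ (f m)) ⟩
  offPathSum w π m + f m             ∎
  where
  open ≡-Reasoning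
  f : ℕ → ℕ
  f k = offPath w π (suc k)

module _ {a ℓ₁ ℓ₂ : Level} (P : StrictPartialOrder a ℓ₁ ℓ₂)
         (n : ℕ) (σ : ℕ → StrictPartialOrder.Carrier P) (w : ℕ → ℕ) where

  defect≡offPathSum : ∀ π → defect P n w π ≡ offPathSum w π n
  defect≡offPathSum π =
    trans unfold-defect (trans (cong sum (map-cong summand (upTo n))) (sum-offPath-upTo w π n))
    where
    -- the summand of defect is local to its definition; unification recovers it
    f : ℕ → ℕ
    f = _
    unfold-defect : defect P n w π ≡ sum (map f (upTo n))
    unfold-defect = refl
    summand : ∀ k → f k ≡ offPath w π (suc k)
    summand k with suc k ∈? π
    ... | yes _ = refl
    ... | no  _ = refl

  _↝_ : ℕ → ℕ → Set ℓ₂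
  _↝_ = Arrow P n σ

  exactMin≤candidateMin : ∀ {C f g t u v} →
    IsMinAt P n σ w (_< t) f t u → IsMinAt P n σ w C g t v →
    (∀ {i} → i < t → f i ≤ g i) → u ≤ v
  exactMin≤candidateMin {f = f} {g} {t} {u} {v} (_ , u-lower) ((i , _ , i↝t , lift v≡) , _) f≤g = begin
    u                              ≤⟨ lower (u-lower i (proj₁ i↝t) i↝t) ⟩
    f i + (W w (t ∸ 1) ∸ W w i)    ≤⟨ +-monoˡ-≤ _ (f≤g (proj₁ i↝t)) ⟩
    g i + (W w (t ∸ 1) ∸ W w i)    ≡⟨ sym v≡ ⟩
    v                              ∎
    where open ≤-Reasoning

  -- Only the fact that r(t) minimises over some candidate set matters, not how Γ maintains R.
  exact≤execution : ∀ {s R r} → IsExactS P n σ w s → IsExecution P n σ w R r →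
                    ∀ j → j ≤ suc n → s j ≤ r j
  exact≤execution {s} {r = r} (lift s0≡0 , s-min) (_ , r-min) = <-rec _ step
    where
    step : ∀ j → (∀ {i} → i < j → i ≤ suc n → s i ≤ r i) → j ≤ suc n → s j ≤ r j
    step zero    _  _     = subst (_≤ r 0) (sym s0≡0) z≤n
    step (suc j) ih j≤1+n =
      exactMin≤candidateMin (s-min (suc j) (s≤s z≤n) j≤1+n) (r-min (suc j) (s≤s z≤n) j≤1+n)
        (λ i<t → ih i<t (≤-trans (<⇒≤ i<t) j≤1+n))

  data ChainInto : ℕ → List ℕ → Set ℓ₂ where
    []     : ∀ {t} → ChainInto t []
    extend : ∀ {i t π} → ChainInto (suc i) π → suc i ↝ t → ChainInto t (π ∷ʳ suc i)

  IsPath-head≤n : ∀ {t τ} → IsPath P n σ (t ∷ τ) → t ≤ n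
  IsPath-head≤n ([ _ ] t≤n)        = t≤n
  IsPath-head≤n (_∷_ _ t<u _ path) = ≤-trans (<⇒≤ t<u) (IsPath-head≤n path)

  ChainInto-++-IsPath : ∀ {t π τ} → ChainInto t π → IsPath P n σ (t ∷ τ) → IsPath P n σ (π ++ t ∷ τ)
  ChainInto-++-IsPath [] path = path
  ChainInto-++-IsPath (extend _ (_ , inj₁ (lift ()))) path
  ChainInto-++-IsPath (extend _ (_ , inj₂ (inj₁ (lift refl)))) path =
    ⊥-elim (<-irrefl refl (IsPath-head≤n path))
  ChainInto-++-IsPath {t} {τ = τ} (extend {i} {π = π} chain (i<t , inj₂ (inj₂ σi◁σt))) path
    rewrite ++-assoc π (suc i ∷ []) (t ∷ τ) = ChainInto-++-IsPath chain (_∷_ (s≤s z≤n) i<t σi◁σt path)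

  ChainInto-top⇒IsPath : ∀ {π} → ChainInto (suc n) π → IsPath P n σ π
  ChainInto-top⇒IsPath []                   = []
  ChainInto-top⇒IsPath (extend chain (i<t , _)) = ChainInto-++-IsPath chain ([ s≤s z≤n ] (≤-pred i<t))

  CheapChainInto : (ℕ → ℕ) → ℕ → Set ℓ₂
  CheapChainInto s t = Σ (List ℕ) λ π → ChainInto t π × offPathSum w π (t ∸ 1) ≤ s t

  -- Backtrack along the indices attaining the minima in the definition of s.
  exact⇒CheapChainInto : ∀ {s} → IsExactS P n σ w s → ∀ t → 1 ≤ t → t ≤ suc n → CheapChainInto s t
  exact⇒CheapChainInto {s} (lift s0≡0 , s-min) = <-rec _ step
    where
    step : ∀ t → (∀ {i} → i < t → 1 ≤ i → i ≤ suc n → CheapChainInto s i) →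
           1 ≤ t → t ≤ suc n → CheapChainInto s t
    step (suc t) ih _ t≤1+n with proj₁ (s-min (suc t) (s≤s z≤n) t≤1+n)
    ... | zero , _ , _ , lift st≡ =
      [] , [] , ≤-trans (offPathSum-≤-W w [] {m = t} z≤n)
                        (≤-reflexive (trans (cong (_+ (W w t ∸ 0)) (sym s0≡0)) (sym st≡)))
    ... | suc i , lift i<1+t , i↝t , lift st≡ with ih i<1+t (s≤s z≤n) (≤-trans (<⇒≤ i<1+t) t≤1+n)
    ...   | π , chain , bound = π′ , extend chain i↝t , extended-bound
      where
      open ≤-Reasoning
      π′ : List ℕ
      π′ = π ∷ʳ suc i
      extended-bound : offPathSum w π′ t ≤ s (suc t)
      extended-bound = begin
        offPathSum w π′ t                                                 ≤⟨ offPathSum-≤-W w π′ (≤-pred i<1+t) ⟩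
        offPathSum w π′ i + offPath w π′ (suc i) + (W w t ∸ W w (suc i))  ≡⟨ cong (λ x → offPathSum w π′ i + x + (W w t ∸ W w (suc i))) (offPath-∈ w (∈-++⁺ʳ π (here refl))) ⟩
        offPathSum w π′ i + 0 + (W w t ∸ W w (suc i))                     ≡⟨ cong (_+ (W w t ∸ W w (suc i))) (+-identityʳ _) ⟩
        offPathSum w π′ i + (W w t ∸ W w (suc i))                         ≤⟨ +-monoˡ-≤ _ (offPathSum-antimono w ∈-++⁺ˡ i) ⟩
        offPathSum w π i + (W w t ∸ W w (suc i))                          ≤⟨ +-monoˡ-≤ _ bound ⟩
        s (suc i) + (W w t ∸ W w (suc i))                                 ≡⟨ sym st≡ ⟩
        s (suc t)                                                         ∎

  dmin≤exact : ∀ {s d} → IsExactS P n σ w s → IsDmin P n σ w d → d ≤ s (suc n)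
  dmin≤exact exact (_ , d-lower) with exact⇒CheapChainInto exact (suc n) (s≤s z≤n) ≤-refl
  ... | π , chain , bound =
    ≤-trans (d-lower π (ChainInto-top⇒IsPath chain)) (subst (_≤ _) (sym (defect≡offPathSum π)) bound)

proposition1 : {a ℓ₁ ℓ₂ : Level} (P : StrictPartialOrder a ℓ₁ ℓ₂)
    (n : ℕ) (σ : ℕ → StrictPartialOrder.Carrier P) (w : ℕ → ℕ)
    (s : ℕ → ℕ) → IsExactS P n σ w s →
    (R : ℕ → ℕ → Set) (r : ℕ → ℕ) → IsExecution P n σ w R r →
    ((j : ℕ) → j ≤ suc n → s j ≤ r j) ×
    ((d : ℕ) → IsDmin P n σ w d → d ≤ r (suc n))
proposition1 P n σ w s exact R r execution = s≤r , λ d dmin →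
  ≤-trans (dmin≤exact P n σ w exact dmin) (s≤r (suc n) ≤-refl)
  where
  s≤r : (j : ℕ) → j ≤ suc n → s j ≤ r j
  s≤r = exact≤execution P n σ w exact execution
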